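{- For every positive integer $k$, let $P$ be the path $(v_1,v_2,\dots,v_{8k})$ with $n=8k$ vertices, and let $I_b=\{v_1,v_3,v_5,\dots,v_{2k-1}\}$ and $I_r=\{v_{6k+2},v_{6k+4},\dots,v_{8k}\}$. Then $I_b\rightsquigarrow_P I_r$, and every reconfiguration sequence between $I_b$ and $I_r$ has length $\Omega(n^2)$.
   Context: For a graph $G$ and independent sets $I,J$ of $G$, $I\leftrightarrow J$ means there is an edge $\{a,b\}\in E(G)$ with $I\setminus J=\{a\}$ and $J\setminus I=\{b\}$ (one token slides along an edge). A reconfiguration sequence between $I_1$ and $I_\ell$ is a sequence $\langle I_1,\dots,I_\ell\rangle$ of independent sets with $I_{i-1}\leftrightarrow I_i$ for $i=2,\dots,\ell$; its length is $\ell$. $I\rightsquigarrow_G J$ means such a sequence between $I$ and $J$ exists. -}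

module Defs where

open import Data.Nat using (ℕ; zero; suc; _+_; _*_; _<ᵇ_; _≡ᵇ_; _%_)
open import Data.Bool using (Bool; _∧_)
open import Data.Fin using (Fin; toℕ)
open import Data.Fin.Subset using (Subset; _∈_; _∉_)
open import Data.Vec using (tabulate)
open import Data.Product using (Σ; _×_; ∃₂)
open import Relation.Binary.PropositionalEquality using (_≡_; _≢_)
open import Relation.Nullary using (¬_)
open import Function.Bundles using (_⇔_)

Adj : ℕ → Set₁
Adj n = Fin n → Fin n → Set

-- Path graph on vertices v₁,…,vₙ, where vⱼ is represented by the Fin n index j-1.
PathAdj : (n : ℕ) → Adj n
PathAdj n i j = (toℕ j ≡ suc (toℕ i)) Data.Sum.⊎ (toℕ i ≡ suc (toℕ j))
  where import Data.Sum

Independent : {n : ℕ} → Adj n → Subset n → Set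
Independent E I = ∀ x y → x ∈ I → y ∈ I → ¬ E x y

Slide : {n : ℕ} → Adj n → Subset n → Subset n → Set
Slide {n} E I J = ∃₂ λ (a b : Fin n) →
  E a b × a ∈ I × a ∉ J × b ∈ J × b ∉ I ×
  (∀ x → x ≢ a → x ≢ b → (x ∈ I ⇔ x ∈ J))

data ReconfSeq {n : ℕ} (E : Adj n) : Subset n → Subset n → ℕ → Set where
  single : ∀ {I} → Independent E I → ReconfSeq E I I 1
  step   : ∀ {I J K ℓ} → Independent E I → Slide E I J → ReconfSeq E J K ℓ →
           ReconfSeq E I K (suc ℓ)

Reachable : {n : ℕ} → Adj n → Subset n → Subset n → Set
Reachable E I J = Σ ℕ λ ℓ → ReconfSeq E I J ℓ

-- I_b = {v₁, v₃, …, v_{2k-1}} : indices m = j-1 even with m < 2k.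
Ib : (k : ℕ) → Subset (8 * k)
Ib k = tabulate λ i → ((toℕ i % 2) ≡ᵇ 0) ∧ (toℕ i <ᵇ (2 * k))

-- I_r = {v_{6k+2}, v_{6k+4}, …, v_{8k}} : indices m = j-1 odd with m > 6k.
Ir : (k : ℕ) → Subset (8 * k)
Ir k = tabulate λ i → ((toℕ i % 2) ≡ᵇ 1) ∧ ((6 * k) <ᵇ toℕ i)

-- The blue tokens are carried across the path one at a time, rightmost first.  When b blue
-- tokens remain, the configuration is "even indices below 2b, odd indices above 6k + 2b";
-- the token at index 2b − 2 then walks, one slide at a time, through the empty stretch up to
-- index 6k + 2b − 1, which yields the configuration for b − 1.
--
-- For the lower bound, weigh a set by Φ(I) = Σ_{m ∈ I} (m ∸ 2k).  Along an edge this weight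
-- grows by at most one, so a single slide raises Φ by at most one.  Φ(I_b) = 0, whereas each of
-- the k tokens of I_r sits beyond index 6k and weighs at least 4k, so every reconfiguration
-- sequence has length at least 4k² = n²/16.
module Submission where

open import Defs
open import Data.Nat hiding (_≟_)
open import Data.Nat.Properties hiding (_≟_)
open import Data.Nat.Tactic.RingSolver using (solve-∀)
open import Data.Bool using (Bool; true; false; T; _∧_; _∨_; if_then_else_)
open import Data.Bool.Properties
  using (T-≡; T-∧; T-∨; ∧-zeroʳ; ∨-assoc; ∨-identityʳ; ¬-not; ⇔→≡; ∨-commutativeMonoid)
open import Data.Fin using (Fin; toℕ; fromℕ<; _≟_) renaming (zero to fzero; suc to fsuc)
open import Data.Fin.Properties using (toℕ-fromℕ<; toℕ-injective; toℕ<n; punchInᵢ≢i)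
open import Data.Fin.Subset using (Subset; _∈_; _∉_; outside)
open import Data.Vec using (lookup; tabulate; _[_]≔_)
open import Data.Vec.Properties
  using (lookup∘tabulate; tabulate-cong; []=⇒lookup; lookup⇒[]=; lookup∘update; lookup∘update′)
open import Data.Vec.Functional using (removeAt)
open import Data.Product using (Σ; _×_; _,_; proj₁; proj₂; map₂)
open import Data.Sum using (_⊎_; inj₁; inj₂; [_,_]′; map₁)
open import Data.Empty using (⊥)
open import Relation.Nullary using (¬_; yes; no)
open import Relation.Binary.PropositionalEquality
open import Function.Base using (_∘_)
open import Function.Bundles using (_⇔_; mk⇔; Equivalence)
open import Function.Construct.Composition using (_⇔-∘_)
open import Function.Construct.Symmetry using (⇔-sym)
open import Algebra.Bundles using (CommutativeMonoid)
open import Algebra.Properties.CommutativeMonoid.Sum +-0-commutativeMonoid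
  using (sum; sum-syntax; sum-remove; sum-cong-≗; sum-replicate-zero)
import Algebra.Properties.CommutativeSemigroup as CommSemigroupProperties

module ∨ = CommSemigroupProperties (CommutativeMonoid.commutativeSemigroup ∨-commutativeMonoid)

Reachable-refl : ∀ {n} {E : Adj n} {I} → Independent E I → Reachable E I I
Reachable-refl indep = 1 , single indep

Reachable-trans : ∀ {n} {E : Adj n} {I J K} → Reachable E I J → Reachable E J K → Reachable E I K
Reachable-trans (_ , single _)             J⇝K = J⇝K
Reachable-trans (_ , step indep slide I⇝J) J⇝K with Reachable-trans (_ , I⇝J) J⇝K
... | ℓ , seq = suc ℓ , step indep slide seq

ReconfSeq-snoc : ∀ {n} {E : Adj n} {I J K ℓ} →
                 ReconfSeq E I J ℓ → Slide E J K → Independent E K → ReconfSeq E I K (suc ℓ)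
ReconfSeq-snoc (single indep)          slide indepK = step indep slide (single indepK)
ReconfSeq-snoc (step indep slide′ seq) slide indepK = step indep slide′ (ReconfSeq-snoc seq slide indepK)

-- Subsets of a path given by predicates on indices

fromPred : ∀ {n} → (ℕ → Bool) → Subset n
fromPred f = tabulate (λ x → f (toℕ x))

∈-fromPred : ∀ {n} f {x : Fin n} → x ∈ fromPred f ⇔ T (f (toℕ x))
∈-fromPred f {x} = mk⇔
  (λ x∈ → Equivalence.from T-≡ (trans (sym (lookup∘tabulate (f ∘ toℕ) x)) ([]=⇒lookup x∈)))
  (λ fx → lookup⇒[]= x _ (trans (lookup∘tabulate (f ∘ toℕ) x) (Equivalence.to T-≡ fx)))

fromPred-cong : ∀ {n} {f g : ℕ → Bool} → (∀ m → m < n → f m ≡ g m) → fromPred {n} f ≡ fromPred g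
fromPred-cong f≡g = tabulate-cong (λ x → f≡g (toℕ x) (toℕ<n x))

NoAdjacent : (ℕ → Bool) → Set
NoAdjacent f = ∀ m → T (f m) → T (f (suc m)) → ⊥

NoAdjacent-mono : ∀ {f g} → (∀ m → T (f m) → T (g m)) → NoAdjacent g → NoAdjacent f
NoAdjacent-mono f⊆g noAdj m fm fsm = noAdj m (f⊆g m fm) (f⊆g (suc m) fsm)

fromPred-independent : ∀ {n} {f} → NoAdjacent f → Independent (PathAdj n) (fromPred f)
fromPred-independent {f = f} noAdj x y x∈ y∈ (inj₁ y≡1+x) =
  noAdj (toℕ x) (Equivalence.to (∈-fromPred f) x∈) (subst (T ∘ f) y≡1+x (Equivalence.to (∈-fromPred f) y∈))
fromPred-independent {f = f} noAdj x y x∈ y∈ (inj₂ x≡1+y) =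
  noAdj (toℕ y) (Equivalence.to (∈-fromPred f) y∈) (subst (T ∘ f) x≡1+y (Equivalence.to (∈-fromPred f) x∈))

fromPred-slide : ∀ {n} {f g : ℕ → Bool} p → suc p < n →
                 T (f p) → ¬ T (g p) → T (g (suc p)) → ¬ T (f (suc p)) →
                 (∀ m → m ≢ p → m ≢ suc p → f m ≡ g m) → Slide (PathAdj n) (fromPred f) (fromPred g)
fromPred-slide {n} {f} {g} p 1+p<n fp ¬gp g1+p ¬f1+p f≡g =
  a , b , inj₁ (trans toℕb (cong suc (sym toℕa))) ,
  from f (subst (T ∘ f) (sym toℕa) fp) , ¬gp ∘ subst (T ∘ g) toℕa ∘ to g ,
  from g (subst (T ∘ g) (sym toℕb) g1+p) , ¬f1+p ∘ subst (T ∘ f) toℕb ∘ to f ,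
  λ x x≢a x≢b → let fx≡gx = f≡g (toℕ x) (x≢a ∘ toℕ-injective ∘ (λ e → trans e (sym toℕa)))
                                        (x≢b ∘ toℕ-injective ∘ (λ e → trans e (sym toℕb)))
                in mk⇔ (from g ∘ subst T fx≡gx ∘ to f) (from f ∘ subst T (sym fx≡gx) ∘ to g)
  where
  p<n = <-trans (n<1+n p) 1+p<n
  a b : Fin n
  a = fromℕ< p<n
  b = fromℕ< 1+p<n
  toℕa = toℕ-fromℕ< p<n
  toℕb = toℕ-fromℕ< 1+p<n
  to : ∀ h {x : Fin n} → x ∈ fromPred h → T (h (toℕ x))
  to h = Equivalence.to (∈-fromPred h)
  from : ∀ h {x : Fin n} → T (h (toℕ x)) → x ∈ fromPred h
  from h = Equivalence.from (∈-fromPred h)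

-- A single token walking to the right

insert : ℕ → (ℕ → Bool) → ℕ → Bool
insert p S m = (m ≡ᵇ p) ∨ S m

T-insert : ∀ p S {m} → T (insert p S m) ⇔ (m ≡ p ⊎ T (S m))
T-insert p S {m} = mk⇔
  (map₁ (≡ᵇ⇒≡ m p) ∘ Equivalence.to T-∨)
  (Equivalence.from T-∨ ∘ map₁ (≡⇒≡ᵇ m p))

insert-≢ : ∀ p S {m} → m ≢ p → insert p S m ≡ S m
insert-≢ p S {m} m≢p = cong (_∨ S m) (¬-not (m≢p ∘ ≡ᵇ⇒≡ m p ∘ Equivalence.from T-≡))

NoAdjacent-insert : ∀ {p S} → NoAdjacent S → ¬ T (S p) → ¬ T (S (suc (suc p))) → NoAdjacent (insert (suc p) S)
NoAdjacent-insert {p} {S} noAdj ¬Sp ¬S2+p m t t′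
  with Equivalence.to (T-insert (suc p) S) t | Equivalence.to (T-insert (suc p) S) t′
... | inj₁ refl | inj₁ 1+m≡m = 1+n≢n 1+m≡m
... | inj₁ refl | inj₂ S2+p  = ¬S2+p S2+p
... | inj₂ Sm   | inj₁ refl  = ¬Sp Sm
... | inj₂ Sm   | inj₂ S1+m  = noAdj m Sm S1+m

insert-slide : ∀ {n p S} → ¬ T (S p) → ¬ T (S (suc p)) → suc p < n →
               Slide (PathAdj n) (fromPred (insert p S)) (fromPred (insert (suc p) S))
insert-slide {p = p} {S} ¬Sp ¬S1+p 1+p<n =
  fromPred-slide {f = insert p S} {g = insert (suc p) S} p 1+p<n
    (Equivalence.from (T-insert p S) (inj₁ refl))
    ([ (λ p≡1+p → 1+n≢n (sym p≡1+p)) , ¬Sp ]′ ∘ Equivalence.to (T-insert (suc p) S))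
    (Equivalence.from (T-insert (suc p) S) (inj₁ refl))
    ([ 1+n≢n , ¬S1+p ]′ ∘ Equivalence.to (T-insert p S))
    (λ m m≢p m≢1+p → trans (insert-≢ p S m≢p) (sym (insert-≢ (suc p) S m≢1+p)))

insert-walk : ∀ {n p q S} → NoAdjacent (insert p S) → (∀ m → p ≤ m → m ≤ suc q → ¬ T (S m)) → p ≤ q → q < n →
              Reachable (PathAdj n) (fromPred (insert p S)) (fromPred (insert q S))
insert-walk {n} {p} {q} {S} noAdj gap p≤q q<n = walk (≤⇒≤′ p≤q) ≤-refl
  where
  noAdjS : NoAdjacent S
  noAdjS = NoAdjacent-mono (λ m Sm → Equivalence.from (T-insert p S) (inj₂ Sm)) noAdj
  walk : ∀ {r} → p ≤′ r → r ≤ q → Reachable (PathAdj n) (fromPred (insert p S)) (fromPred (insert r S))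
  walk ≤′-refl _ = Reachable-refl (fromPred-independent noAdj)
  walk (≤′-step {r} p≤′r) 1+r≤q with walk p≤′r (≤-trans (n≤1+n r) 1+r≤q)
  ... | ℓ , seq = suc ℓ , ReconfSeq-snoc seq
                            (insert-slide ¬Sr ¬S1+r (≤-<-trans 1+r≤q q<n))
                            (fromPred-independent (NoAdjacent-insert noAdjS ¬Sr ¬S2+r))
    where
    p≤r = ≤′⇒≤ p≤′r
    ¬Sr = gap r p≤r (≤-trans (n≤1+n r) (m≤n⇒m≤1+n 1+r≤q))
    ¬S1+r = gap (suc r) (m≤n⇒m≤1+n p≤r) (m≤n⇒m≤1+n 1+r≤q)
    ¬S2+r = gap (suc (suc r)) (m≤n⇒m≤1+n (m≤n⇒m≤1+n p≤r)) (s≤s 1+r≤q)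

-- (2 + m) % 2 reduces to m % 2, so the identities below hold by recursion with refl leaves.

Even : ℕ → Set
Even m = m % 2 ≡ 0

-- Written t * 2 + c rather than 2 * t + c because suc t * 2 + c then reduces to 2 + (t * 2 + c).
Even-+2* : ∀ t {c} → Even c → Even (t * 2 + c)
Even-+2* zero    even = even
Even-+2* (suc t) even = Even-+2* t even

Even-6* : ∀ k → Even (6 * k)
Even-6* k = subst Even (3k*2+0≡6k k) (Even-+2* (3 * k) refl)
  where
  3k*2+0≡6k : ∀ k → 3 * k * 2 + 0 ≡ 6 * k
  3k*2+0≡6k = solve-∀

evenBelow : ℕ → ℕ → Bool
evenBelow c m = (m % 2 ≡ᵇ 0) ∧ (m <ᵇ c)

oddAbove : ℕ → ℕ → Bool
oddAbove d m = (m % 2 ≡ᵇ 1) ∧ (d <ᵇ m)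

T-evenBelow : ∀ c m → T (evenBelow c m) → T (m % 2 ≡ᵇ 0) × m < c
T-evenBelow c m = map₂ (<ᵇ⇒< m c) ∘ Equivalence.to T-∧

T-oddAbove : ∀ d m → T (oddAbove d m) → T (m % 2 ≡ᵇ 1) × d < m
T-oddAbove d m = map₂ (<ᵇ⇒< d m) ∘ Equivalence.to T-∧

evenBelow-2+≡insert : ∀ c m → Even c → evenBelow (2 + c) m ≡ insert c (evenBelow c) m
evenBelow-2+≡insert zero          zero          _    = refl
evenBelow-2+≡insert zero          (suc zero)    _    = refl
evenBelow-2+≡insert zero          (suc (suc m)) _    = refl
evenBelow-2+≡insert (suc zero)    _             ()
evenBelow-2+≡insert (suc (suc c)) zero          _    = refl
evenBelow-2+≡insert (suc (suc c)) (suc zero)    _    = refl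
evenBelow-2+≡insert (suc (suc c)) (suc (suc m)) even = evenBelow-2+≡insert c m even

oddAbove≡insert : ∀ d m → Even d → oddAbove d m ≡ insert (suc d) (oddAbove (2 + d)) m
oddAbove≡insert zero          zero                _    = refl
oddAbove≡insert zero          (suc zero)          _    = refl
oddAbove≡insert zero          (suc (suc zero))    _    = refl
oddAbove≡insert zero          (suc (suc (suc m))) _    = refl
oddAbove≡insert (suc zero)    _                   ()
oddAbove≡insert (suc (suc d)) zero                _    = refl
oddAbove≡insert (suc (suc d)) (suc zero)          _    = refl
oddAbove≡insert (suc (suc d)) (suc (suc m))       even = oddAbove≡insert d m even

oddAbove-≥ : ∀ {d m} → m ≤ d → oddAbove d m ≡ false
oddAbove-≥ {d} {m} m≤d =
  trans (cong ((m % 2 ≡ᵇ 1) ∧_) (¬-not (λ eq → <⇒≱ (<ᵇ⇒< d m (Equivalence.from T-≡ eq)) m≤d))) (∧-zeroʳ _)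

even-suc-not-even : ∀ m → T (m % 2 ≡ᵇ 0) → ¬ T (suc m % 2 ≡ᵇ 0)
even-suc-not-even (suc (suc m)) = even-suc-not-even m

odd-suc-not-odd : ∀ m → T (m % 2 ≡ᵇ 1) → ¬ T (suc m % 2 ≡ᵇ 1)
odd-suc-not-odd (suc (suc m)) = odd-suc-not-odd m

odd-or-suc-odd : ∀ m → T (m % 2 ≡ᵇ 1) ⊎ T (suc m % 2 ≡ᵇ 1)
odd-or-suc-odd zero          = inj₂ _
odd-or-suc-odd (suc zero)    = inj₁ _
odd-or-suc-odd (suc (suc m)) = odd-or-suc-odd m

oddAbove-either : ∀ {d m} → Even d → d ≤ m → T (oddAbove d m) ⊎ T (oddAbove d (suc m))
oddAbove-either {d} {m} even d≤m with odd-or-suc-odd m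
... | inj₁ odd = inj₁ (Equivalence.from T-∧ (odd , <⇒<ᵇ (≤∧≢⇒< d≤m d≢m)))
  where
  d≢m : d ≢ m
  d≢m refl = subst (λ r → T (r ≡ᵇ 1)) even odd
... | inj₂ odd = inj₂ (Equivalence.from T-∧ (odd , <⇒<ᵇ (s≤s d≤m)))

-- Moving the blue tokens across

-- blueRed (2 * b) (6 * k + 2 * b) is the configuration in which b blue tokens remain.
blueRed : ℕ → ℕ → ℕ → Bool
blueRed c d m = evenBelow c m ∨ oddAbove d m

blueRed-noAdjacent : ∀ {c d} → c ≤ d → NoAdjacent (blueRed c d)
blueRed-noAdjacent {c} {d} c≤d m t t′
  with Equivalence.to (T-∨ {evenBelow c m}) t | Equivalence.to (T-∨ {evenBelow c (suc m)}) t′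
... | inj₁ blue | inj₁ blue′ =
  even-suc-not-even m (proj₁ (T-evenBelow c m blue)) (proj₁ (T-evenBelow c (suc m) blue′))
... | inj₂ red  | inj₂ red′  =
  odd-suc-not-odd m (proj₁ (T-oddAbove d m red)) (proj₁ (T-oddAbove d (suc m) red′))
... | inj₁ blue | inj₂ red′  =
  <⇒≱ (proj₂ (T-evenBelow c m blue)) (≤-trans c≤d (≤-pred (proj₂ (T-oddAbove d (suc m) red′))))
... | inj₂ red  | inj₁ blue′ =
  <⇒≱ (proj₂ (T-oddAbove d m red)) (≤-trans (n≤1+n m) (≤-trans (<⇒≤ (proj₂ (T-evenBelow c (suc m) blue′))) c≤d))

blueRed-move : ∀ {n c d} → Even c → Even d → c ≤ d → suc d < n →
               Reachable (PathAdj n) (fromPred (blueRed (2 + c) (2 + d))) (fromPred (blueRed c d))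
blueRed-move {n} {c} {d} even-c even-d c≤d 1+d<n =
  subst₂ (Reachable (PathAdj n)) (fromPred-cong (λ m _ → sym (start m))) (fromPred-cong (λ m _ → sym (end m)))
    (insert-walk noAdj gap (m≤n⇒m≤1+n c≤d) 1+d<n)
  where
  S = blueRed c (2 + d)
  start : ∀ m → blueRed (2 + c) (2 + d) m ≡ insert c S m
  start m = trans (cong (_∨ oddAbove (2 + d) m) (evenBelow-2+≡insert c m even-c)) (∨-assoc (m ≡ᵇ c) _ _)
  end : ∀ m → blueRed c d m ≡ insert (suc d) S m
  end m = trans (cong (evenBelow c m ∨_) (oddAbove≡insert d m even-d))
                (∨.x∙yz≈y∙xz (evenBelow c m) (m ≡ᵇ suc d) (oddAbove (2 + d) m))
  noAdj : NoAdjacent (insert c S)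
  noAdj = NoAdjacent-mono (λ m → subst T (sym (start m))) (blueRed-noAdjacent (s≤s (s≤s c≤d)))
  gap : ∀ m → c ≤ m → m ≤ suc (suc d) → ¬ T (S m)
  gap m c≤m m≤2+d t with Equivalence.to (T-∨ {evenBelow c m}) t
  ... | inj₁ blue = <⇒≱ (proj₂ (T-evenBelow c m blue)) c≤m
  ... | inj₂ red  = <⇒≱ (proj₂ (T-oddAbove (2 + d) m red)) m≤2+d

blueRed-sweep : ∀ {n c d} t → Even c → Even d → c ≤ d → t * 2 + d ≤ n →
                Reachable (PathAdj n) (fromPred (blueRed (t * 2 + c) (t * 2 + d))) (fromPred (blueRed c d))
blueRed-sweep zero    _      _      c≤d _     = Reachable-refl (fromPred-independent (blueRed-noAdjacent c≤d))
blueRed-sweep (suc t) even-c even-d c≤d bound = Reachable-trans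
  (blueRed-move (Even-+2* t even-c) (Even-+2* t even-d) (+-monoʳ-≤ (t * 2) c≤d) bound)
  (blueRed-sweep t even-c even-d c≤d (m+n≤o⇒n≤o 2 bound))

Ib⇝Ir : ∀ k → Reachable (PathAdj (8 * k)) (Ib k) (Ir k)
Ib⇝Ir k = subst₂ (Reachable (PathAdj (8 * k))) (fromPred-cong start) (fromPred-cong end)
  (blueRed-sweep k refl (Even-6* k) z≤n (≤-reflexive (k*2+6k≡8k k)))
  where
  k*2+6k≡8k : ∀ k → k * 2 + 6 * k ≡ 8 * k
  k*2+6k≡8k = solve-∀
  k*2+0≡2k : ∀ k → k * 2 + 0 ≡ 2 * k
  k*2+0≡2k = solve-∀
  start : ∀ m → m < 8 * k → blueRed (k * 2 + 0) (k * 2 + 6 * k) m ≡ evenBelow (2 * k) m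
  start m m<8k = trans (cong₂ _∨_ (cong (λ c → evenBelow c m) (k*2+0≡2k k))
                                  (oddAbove-≥ (<⇒≤ (<-≤-trans m<8k (≤-reflexive (sym (k*2+6k≡8k k)))))))
                       (∨-identityʳ _)
  end : ∀ m → m < 8 * k → blueRed 0 (6 * k) m ≡ oddAbove (6 * k) m
  end m _ = cong (_∨ oddAbove (6 * k) m) (∧-zeroʳ _)

sum-mono-≤ : ∀ {n} {u v : Fin n → ℕ} → (∀ x → u x ≤ v x) → sum u ≤ sum v
sum-mono-≤ {zero}  _   = z≤n
sum-mono-≤ {suc n} u≤v = +-mono-≤ (u≤v fzero) (sum-mono-≤ (u≤v ∘ fsuc))

sum-shift : ∀ s r (g : ℕ → ℕ) → ∑[ x < r ] g (s + toℕ x) ≤ ∑[ x < s + r ] g (toℕ x)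
sum-shift zero    r g = ≤-refl
sum-shift (suc s) r g = ≤-trans (sum-shift s r (g ∘ suc)) (m≤n+m _ (g 0))

sum-pairs : ∀ t {c} (g : ℕ → ℕ) → (∀ m → c ≤ g m + g (suc m)) → t * c ≤ ∑[ x < t * 2 ] g (toℕ x)
sum-pairs zero    g pair = z≤n
sum-pairs (suc t) g pair = ≤-trans (+-mono-≤ (pair 0) (sum-pairs t (g ∘ suc ∘ suc) (pair ∘ suc ∘ suc)))
                                   (≤-reflexive (+-assoc (g 0) (g 1) _))

if-mono-≤ : ∀ b {u v} → (T b → u ≤ v) → (if b then u else 0) ≤ (if b then v else 0)
if-mono-≤ true  u≤v = u≤v _
if-mono-≤ false _   = z≤n

if-T : ∀ {b u} → T b → (if b then u else 0) ≡ u
if-T {true} _ = refl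

-- The weight potential

weight : ∀ {n} → (Fin n → ℕ) → Subset n → ℕ
weight {n} w I = ∑[ x < n ] (if lookup I x then w x else 0)

∈⇔lookup≡true : ∀ {n} {I : Subset n} {x} → x ∈ I ⇔ lookup I x ≡ true
∈⇔lookup≡true {I = I} {x} = mk⇔ []=⇒lookup (lookup⇒[]= x I)

∉⇒lookup≡false : ∀ {n} {I : Subset n} {x} → x ∉ I → lookup I x ≡ false
∉⇒lookup≡false x∉I = ¬-not (x∉I ∘ Equivalence.from ∈⇔lookup≡true)

⇔⇒lookup≡ : ∀ {n} {I J : Subset n} {x} → (x ∈ I ⇔ x ∈ J) → lookup I x ≡ lookup J x
⇔⇒lookup≡ I⇔J = ⇔→≡ (∈⇔lookup≡true ⇔-∘ (I⇔J ⇔-∘ ⇔-sym ∈⇔lookup≡true))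

weight-cong : ∀ {n} (w : Fin n → ℕ) {I J : Subset n} → (∀ x → lookup I x ≡ lookup J x) → weight w I ≡ weight w J
weight-cong w I≗J = sum-cong-≗ (λ x → cong (λ b → if b then w x else 0) (I≗J x))

weight-≡0 : ∀ {n} (w : Fin n → ℕ) {I : Subset n} → (∀ x → x ∈ I → w x ≡ 0) → weight w I ≡ 0
weight-≡0 {n} w {I} vanishes = trans (sum-cong-≗ pointwise) (sum-replicate-zero n)
  where
  pointwise : ∀ x → (if lookup I x then w x else 0) ≡ 0
  pointwise x with lookup I x in eq
  ... | true  = vanishes x (lookup⇒[]= x I eq)
  ... | false = refl

weight-fromPred : ∀ {n} (w : Fin n → ℕ) f → weight w (fromPred f) ≡ ∑[ x < n ] (if f (toℕ x) then w x else 0)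
weight-fromPred w f = sum-cong-≗ (λ x → cong (λ b → if b then w x else 0) (lookup∘tabulate (f ∘ toℕ) x))

weight-remove : ∀ {n} (w : Fin n → ℕ) {I : Subset n} {a} → a ∈ I → weight w I ≡ weight w (I [ a ]≔ outside) + w a
weight-remove {suc n} w {I} {a} a∈I = begin
  weight w I                                           ≡⟨ sum-remove {i = a} (contribution I) ⟩
  contribution I a + sum (removeAt (contribution I) a)
    ≡⟨ cong₂ _+_ (cong (λ b → if b then w a else 0) ([]=⇒lookup a∈I)) (sum-cong-≗ agree) ⟩
  w a + rest                                           ≡⟨ +-comm (w a) rest ⟩
  rest + w a                                           ≡⟨ cong (_+ w a) removed ⟩
  weight w I′ + w a                                    ∎
  where
  open ≡-Reasoning
  I′ = I [ a ]≔ outside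
  contribution : Subset (suc n) → Fin (suc n) → ℕ
  contribution K x = if lookup K x then w x else 0
  rest = sum (removeAt (contribution I′) a)
  agree : ∀ j → removeAt (contribution I) a j ≡ removeAt (contribution I′) a j
  agree j = cong (λ b → if b then _ else 0) (sym (lookup∘update′ (punchInᵢ≢i a j) I outside))
  removed : rest ≡ weight w I′
  removed = sym (trans (sum-remove {i = a} (contribution I′))
                       (cong (λ b → (if b then w a else 0) + rest) (lookup∘update a I outside)))

Lipschitz : ∀ {n} → Adj n → (Fin n → ℕ) → Set
Lipschitz E w = ∀ {a b} → E a b → w b ≤ suc (w a)

weight-slide : ∀ {n} {E : Adj n} {w} {I J} → Lipschitz E w → Slide E I J → weight w J ≤ suc (weight w I)
weight-slide {E = E} {w} {I} {J} lipschitz (a , b , ab , a∈I , a∉J , b∈J , b∉I , I⇔J) = begin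
  weight w J                        ≡⟨ weight-remove w b∈J ⟩
  weight w (J [ b ]≔ outside) + w b ≡⟨ cong (_+ w b) (weight-cong w {J [ b ]≔ outside} {I′} same) ⟩
  weight w I′ + w b                 ≤⟨ +-monoʳ-≤ (weight w I′) (lipschitz ab) ⟩
  weight w I′ + suc (w a)           ≡⟨ +-suc _ _ ⟩
  suc (weight w I′ + w a)           ≡⟨ cong suc (weight-remove w a∈I) ⟨
  suc (weight w I)                  ∎
  where
  open ≤-Reasoning
  I′ = I [ a ]≔ outside
  same : ∀ x → lookup (J [ b ]≔ outside) x ≡ lookup I′ x
  same x with x ≟ a | x ≟ b
  ... | yes refl | _ = trans (lookup∘update′ (λ a≡b → a∉J (subst (_∈ J) (sym a≡b) b∈J)) J outside)
                             (trans (∉⇒lookup≡false a∉J) (sym (lookup∘update x I outside)))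
  ... | no x≢a | yes refl = trans (lookup∘update x J outside)
                                  (sym (trans (lookup∘update′ x≢a I outside) (∉⇒lookup≡false b∉I)))
  ... | no x≢a | no x≢b = trans (lookup∘update′ x≢b J outside)
                                (trans (sym (⇔⇒lookup≡ (I⇔J x x≢a x≢b))) (sym (lookup∘update′ x≢a I outside)))

weight-reconf : ∀ {n} {E : Adj n} {w} {I J ℓ} → Lipschitz E w → ReconfSeq E I J ℓ → weight w J ≤ weight w I + ℓ
weight-reconf lipschitz (single _) = m≤m+n _ 1
weight-reconf {w = w} {I} lipschitz (step {ℓ = ℓ} _ slide rest) = begin
  _                          ≤⟨ weight-reconf lipschitz rest ⟩
  _ + ℓ                      ≤⟨ +-monoˡ-≤ ℓ (weight-slide lipschitz slide) ⟩
  suc (weight w I) + ℓ       ≡⟨ +-suc (weight w I) ℓ ⟨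
  weight w I + suc ℓ         ∎
  where open ≤-Reasoning

offset : ∀ {n} → ℕ → Fin n → ℕ
offset c x = toℕ x ∸ c

suc-∸-≤ : ∀ m c → suc m ∸ c ≤ suc (m ∸ c)
suc-∸-≤ m c = m≤n+o⇒m∸n≤o (suc m) c (≤-trans (s≤s (m≤n+m∸n m c)) (≤-reflexive (sym (+-suc c (m ∸ c)))))

PathAdj-lipschitz : ∀ {n} c → Lipschitz (PathAdj n) (offset c)
PathAdj-lipschitz c {a} (inj₁ b≡1+a) rewrite b≡1+a = suc-∸-≤ (toℕ a) c
PathAdj-lipschitz c {a} {b} (inj₂ a≡1+b) =
  m≤n⇒m≤1+n (∸-monoˡ-≤ c (≤-trans (n≤1+n (toℕ b)) (≤-reflexive (sym a≡1+b))))

weight-Ib : ∀ k → weight (offset (2 * k)) (Ib k) ≡ 0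
weight-Ib k = weight-≡0 {8 * k} (offset (2 * k)) λ x x∈Ib →
  m≤n⇒m∸n≡0 (<⇒≤ (proj₂ (T-evenBelow (2 * k) (toℕ x) (Equivalence.to (∈-fromPred (evenBelow (2 * k))) x∈Ib))))

weight-Ir : ∀ k → k * (4 * k) ≤ weight (offset (2 * k)) (Ir k)
weight-Ir k = begin
  k * (4 * k)                            ≤⟨ sum-pairs k (λ m → h (6 * k + m)) pair ⟩
  ∑[ x < k * 2 ] h (6 * k + toℕ x)       ≤⟨ sum-shift (6 * k) (k * 2) h ⟩
  ∑[ x < 6 * k + k * 2 ] h (toℕ x)       ≡⟨ cong (λ n → ∑[ x < n ] h (toℕ x)) (6k+k*2≡8k k) ⟩
  ∑[ x < 8 * k ] h (toℕ x)
    ≤⟨ sum-mono-≤ {8 * k} (λ x → if-mono-≤ (oddAbove (6 * k) (toℕ x)) (far (toℕ x))) ⟩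
  ∑[ x < 8 * k ] (if oddAbove (6 * k) (toℕ x) then toℕ x ∸ 2 * k else 0)
    ≡⟨ weight-fromPred {8 * k} (offset (2 * k)) (oddAbove (6 * k)) ⟨
  weight (offset (2 * k)) (Ir k)         ∎
  where
  open ≤-Reasoning
  h : ℕ → ℕ
  h m = if oddAbove (6 * k) m then 4 * k else 0
  6k+k*2≡8k : ∀ k → 6 * k + k * 2 ≡ 8 * k
  6k+k*2≡8k = solve-∀
  6k≡4k+2k : ∀ k → 6 * k ≡ 4 * k + 2 * k
  6k≡4k+2k = solve-∀
  far : ∀ m → T (oddAbove (6 * k) m) → 4 * k ≤ m ∸ 2 * k
  far m red = begin
    4 * k                 ≡⟨ m+n∸n≡m (4 * k) (2 * k) ⟨
    4 * k + 2 * k ∸ 2 * k ≡⟨ cong (_∸ 2 * k) (6k≡4k+2k k) ⟨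
    6 * k ∸ 2 * k         ≤⟨ ∸-monoˡ-≤ (2 * k) (<⇒≤ (proj₂ (T-oddAbove (6 * k) m red))) ⟩
    m ∸ 2 * k             ∎
  pair : ∀ m → 4 * k ≤ h (6 * k + m) + h (6 * k + suc m)
  pair m with oddAbove-either (Even-6* k) (m≤m+n (6 * k) m)
  ... | inj₁ red = ≤-trans (≤-reflexive (sym (if-T red))) (m≤m+n _ _)
  ... | inj₂ red = ≤-trans (≤-reflexive (sym (if-T (subst (T ∘ oddAbove (6 * k)) (sym (+-suc (6 * k) m)) red))))
                           (m≤n+m _ _)

Ib⇝Ir-length : ∀ k {ℓ} → ReconfSeq (PathAdj (8 * k)) (Ib k) (Ir k) ℓ → (8 * k) * (8 * k) ≤ 16 * ℓ
Ib⇝Ir-length k {ℓ} seq = begin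
  (8 * k) * (8 * k)                         ≡⟨ square k ⟩
  16 * (k * (4 * k))                        ≤⟨ *-monoʳ-≤ 16 (weight-Ir k) ⟩
  16 * weight (offset (2 * k)) (Ir k)       ≤⟨ *-monoʳ-≤ 16 (weight-reconf (PathAdj-lipschitz (2 * k)) seq) ⟩
  16 * (weight (offset (2 * k)) (Ib k) + ℓ) ≡⟨ cong (λ w → 16 * (w + ℓ)) (weight-Ib k) ⟩
  16 * ℓ                                    ∎
  where
  open ≤-Reasoning
  square : ∀ k → (8 * k) * (8 * k) ≡ 16 * (k * (4 * k))
  square = solve-∀

mainTheorem12 : ((k : ℕ) → k ≥ 1 → Reachable (PathAdj (8 * k)) (Ib k) (Ir k))
    × Σ ℕ (λ d → Σ ℕ (λ k₀ → (k : ℕ) → k ≥ 1 → k ≥ k₀ → (ℓ : ℕ)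
        → ReconfSeq (PathAdj (8 * k)) (Ib k) (Ir k) ℓ
        → (8 * k) * (8 * k) ≤ suc d * ℓ))
mainTheorem12 = (λ k _ → Ib⇝Ir k) , 15 , 0 , λ k _ _ ℓ seq → Ib⇝Ir-length k seq
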